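{- In every $\mathbf{DHS}_{PAL}$-derivation whose end DHS is $G$, every formula occurring in the derivation is a subformula of some formula occurring in $G$ or of some formula occurring as an announcement (i.e. as an element of a label) in $G$.
   Context: Formulas of $\mathcal{L}_{PAL}$ are generated by $A ::= p \mid \neg A \mid (A\wedge A) \mid \Box A \mid [A]A$ from a countable set of atoms. A list of announcements is a finite (possibly empty, $\epsilon$) sequence of formulas, $\alpha\cdot A$ its extension by $A$. A sequent is $M\Rightarrow N$ ($M,N$ finite multisets); $A,\Gamma$ / $\Gamma,A$ add $A$ to antecedent / succedent. A dynamic sequent is $/\!/_{\alpha_1}\Gamma_1/\!/\cdots/\!/_{\alpha_n}\Gamma_n$ (components labelled by lists of announcements; $/\!/_\epsilon\Gamma$ written $\Gamma$); a DHS is $X_1\mid\cdots\mid X_n$ of dynamic sequents. $G\mid X/\!/_\alpha M\Rightarrow N$ denotes a DHS with a dynamic sequent having component labelled $\alpha$ equal to $M\Rightarrow N$, $X$ the rest of that dynamic sequent and $G$ the rest of the DHS (possibly empty). Calculus $\mathbf{DHS}_{PAL}$ (notation "premises / conclusion"; the cut rule is not part of it): Axioms $G\mid X/\!/_\alpha p,M\Rightarrow N,p$. (L$\neg$) $G\mid X/\!/_\alpha M\Rightarrow N,A$ / $G\mid X/\!/_\alpha\neg A,M\Rightarrow N$; (R$\neg$) $G\mid X/\!/_\alpha A,M\Rightarrow N$ / $G\mid X/\!/_\alpha M\Rightarrow N,\neg A$; (L$\wedge$) $G\mid X/\!/_\alpha A,B,M\Rightarrow N$ / $G\mid X/\!/_\alpha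 A\wedge B,M\Rightarrow N$; (R$\wedge$) $G\mid X/\!/_\alpha M\Rightarrow N,A$ and $G\mid X/\!/_\alpha M\Rightarrow N,B$ / $G\mid X/\!/_\alpha M\Rightarrow N,A\wedge B$; (L$\Box_1$) $G\mid X/\!/_\alpha\Box A,A,M\Rightarrow N$ / $G\mid X/\!/_\alpha\Box A,M\Rightarrow N$; (R$\Box$) $G\mid X/\!/_\alpha M\Rightarrow N\mid/\!/_\alpha\Rightarrow A$ / $G\mid X/\!/_\alpha M\Rightarrow N,\Box A$; (L$\Box_2$) $G\mid X/\!/_\alpha\Box A,M\Rightarrow N\mid Y/\!/_\alpha A,P\Rightarrow Q$ / $G\mid X/\!/_\alpha\Box A,M\Rightarrow N\mid Y/\!/_\alpha P\Rightarrow Q$; (L$\Box_3$) with $\beta=B_1\cdots B_n$, $\overline{Y}=Y/\!/_{\alpha\cdot\beta}\Box A,\Delta$: premises $G\mid X/\!/_\alpha\Gamma,B_1\mid\overline{Y}$, $G\mid X/\!/_\alpha\Gamma/\!/_{\alpha\cdot B_1\cdots B_i}\Rightarrow B_{i+1}\mid\overline{Y}$ ($1\le i<n$), $G\mid X/\!/_\alpha\Gamma/\!/_{\alpha\cdot\beta}A\Rightarrow\ \mid\overline{Y}$, conclusion $G\mid X/\!/_\alpha\Gamma\mid Y/\!/_{\alpha\cdot\beta}\Box A,\Delta$; (L$[\cdot]$) $G\mid X/\!/_\alpha M\Rightarrow N,A/\!/_{\alpha\cdot A}M'\Rightarrow N'$ and $G\mid X/\!/_\alpha M\Rightarrow N/\!/_{\alpha\cdot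 A}B,M'\Rightarrow N'$ / $G\mid X/\!/_\alpha[A]B,M\Rightarrow N/\!/_{\alpha\cdot A}M'\Rightarrow N'$; (R$[\cdot]$) $G\mid X/\!/_\alpha A,M\Rightarrow N/\!/_{\alpha\cdot A}M'\Rightarrow N',B$ / $G\mid X/\!/_\alpha M\Rightarrow N,[A]B/\!/_{\alpha\cdot A}M'\Rightarrow N'$ (in both, if no $\alpha\cdot A$ component is in the conclusion, the premises — for (L$[\cdot]$) the right one — contain a new component $/\!/_{\alpha\cdot A}$ with $M',N'$ empty); (Lat) $G\mid X/\!/_\alpha p,M\Rightarrow N/\!/_{\alpha\cdot A}p,M'\Rightarrow N'$ / $G\mid X/\!/_\alpha M\Rightarrow N/\!/_{\alpha\cdot A}p,M'\Rightarrow N'$; (Rat) $G\mid X/\!/_\alpha M\Rightarrow N,p/\!/_{\alpha\cdot A}M'\Rightarrow N',p$ / $G\mid X/\!/_\alpha M\Rightarrow N/\!/_{\alpha\cdot A}M'\Rightarrow N',p$; (New) $G\mid X/\!/_\alpha\Rightarrow\ /\!/_{\alpha\cdot A}M\Rightarrow N$ / $G\mid X/\!/_{\alpha\cdot A}M\Rightarrow N$; (Recall) $G\mid X/\!/_\alpha A,M\Rightarrow N/\!/_{\alpha\cdot A}M'\Rightarrow N'$ / $G\mid X/\!/_\alpha M\Rightarrow N/\!/_{\alpha\cdot A}M'\Rightarrow N'$. -}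

module Defs where

open import Data.Nat using (ℕ)
open import Data.List using (List; []; _∷_; [_]; _++_; _∷ʳ_; map)
open import Data.List.Membership.Propositional using (_∈_)
open import Data.List.Relation.Unary.All as All using (All)
open import Data.List.Relation.Unary.Any using (Any)
open import Data.List.Relation.Binary.Permutation.Propositional using (_↭_)
open import Data.List.Relation.Binary.Pointwise using (Pointwise)
open import Data.Product using (_×_; _,_; proj₁; ∃-syntax)
open import Data.Sum using (_⊎_)
open import Relation.Binary.PropositionalEquality using (_≡_; _≢_)

data Fm : Set where
  atom : ℕ → Fm
  ¬'   : Fm → Fm
  _∧'_ : Fm → Fm → Fm
  □    : Fm → Fm
  ⟦_⟧_ : Fm → Fm → Fm

data Sub : Fm → Fm → Set where
  refl  : ∀ {A} → Sub A A
  in¬   : ∀ {A B} → Sub A B → Sub A (¬' B)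
  in∧ˡ  : ∀ {A B C} → Sub A B → Sub A (B ∧' C)
  in∧ʳ  : ∀ {A B C} → Sub A C → Sub A (B ∧' C)
  in□   : ∀ {A B} → Sub A B → Sub A (□ B)
  in[]ˡ : ∀ {A B C} → Sub A B → Sub A (⟦ B ⟧ C)
  in[]ʳ : ∀ {A B C} → Sub A C → Sub A (⟦ B ⟧ C)

-- Lists of announcements, sequents, dynamic sequents, DHS.
-- Multisets are represented by lists taken up to permutation (see _≈_ and
-- the structural rule `perm`); α·A is  α ∷ʳ A.

Label : Set
Label = List Fm

infix 5 _⇒_
record Sequent : Set where
  constructor _⇒_
  field
    ante : List Fm
    succ : List Fm
open Sequent public

Comp : Set
Comp = Label × Sequent

DSeq : Set
DSeq = List Comp

DHS : Set
DHS = List DSeq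

SeqEq : Sequent → Sequent → Set
SeqEq s t = (ante s ↭ ante t) × (succ s ↭ succ t)

CompEq : Comp → Comp → Set
CompEq (α , s) (β , t) = (α ≡ β) × SeqEq s t

DSeqEq : DSeq → DSeq → Set
DSeqEq X Y = ∃[ X' ] ((X ↭ X') × Pointwise CompEq X' Y)

_≈_ : DHS → DHS → Set
G ≈ H = ∃[ G' ] ((G ↭ G') × Pointwise DSeqEq G' H)

NoLabel : Label → DSeq → Set
NoLabel l X = All (λ c → proj₁ c ≢ l) X

-- for β = B₁⋯Bₙ: the pairs (α·B₁⋯Bᵢ , Bᵢ₊₁) for 1 ≤ i < n
steps : Label → List Fm → List (Label × Fm)
steps α [] = []
steps α (B ∷ []) = []
steps α (B ∷ C ∷ Bs) = (α ∷ʳ B , C) ∷ steps (α ∷ʳ B) (C ∷ Bs)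

-- Rule instances of DHS_PAL: Rule premises conclusion.
-- The principal dynamic sequent/components are written first; `perm`
-- makes the position irrelevant.

data Rule : List DHS → DHS → Set where
  ax   : ∀ {G X α p M N} →
         Rule [] (((α , (atom p ∷ M) ⇒ (atom p ∷ N)) ∷ X) ∷ G)
  L¬   : ∀ {G X α A M N} →
         Rule [ ((α , M ⇒ (A ∷ N)) ∷ X) ∷ G ]
              (((α , (¬' A ∷ M) ⇒ N) ∷ X) ∷ G)
  R¬   : ∀ {G X α A M N} →
         Rule [ ((α , (A ∷ M) ⇒ N) ∷ X) ∷ G ]
              (((α , M ⇒ (¬' A ∷ N)) ∷ X) ∷ G)
  L∧   : ∀ {G X α A B M N} →
         Rule [ ((α , (A ∷ B ∷ M) ⇒ N) ∷ X) ∷ G ]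
              (((α , ((A ∧' B) ∷ M) ⇒ N) ∷ X) ∷ G)
  R∧   : ∀ {G X α A B M N} →
         Rule ((((α , M ⇒ (A ∷ N)) ∷ X) ∷ G) ∷ (((α , M ⇒ (B ∷ N)) ∷ X) ∷ G) ∷ [])
              (((α , M ⇒ ((A ∧' B) ∷ N)) ∷ X) ∷ G)
  L□₁  : ∀ {G X α A M N} →
         Rule [ ((α , (□ A ∷ A ∷ M) ⇒ N) ∷ X) ∷ G ]
              (((α , (□ A ∷ M) ⇒ N) ∷ X) ∷ G)
  R□   : ∀ {G X α A M N} →
         Rule [ ((α , M ⇒ N) ∷ X) ∷ ((α , [] ⇒ [ A ]) ∷ []) ∷ G ]
              (((α , M ⇒ (□ A ∷ N)) ∷ X) ∷ G)
  L□₂  : ∀ {G X Y α A M N P Q} →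
         Rule [ ((α , (□ A ∷ M) ⇒ N) ∷ X) ∷ ((α , (A ∷ P) ⇒ Q) ∷ Y) ∷ G ]
              (((α , (□ A ∷ M) ⇒ N) ∷ X) ∷ ((α , P ⇒ Q) ∷ Y) ∷ G)
  -- β = B ∷ Bs (n ≥ 1), Γ and Δ sequents
  L□₃  : ∀ {G X Y α A} (Γ Δ : Sequent) (B : Fm) (Bs : List Fm) →
         Rule ((((α , ante Γ ⇒ (B ∷ succ Γ)) ∷ X)
                  ∷ ((α ++ (B ∷ Bs) , (□ A ∷ ante Δ) ⇒ succ Δ) ∷ Y) ∷ G)
               ∷ (map (λ lc → ((α , Γ) ∷ (proj₁ lc , [] ⇒ [ Data.Product.proj₂ lc ]) ∷ X)
                                ∷ ((α ++ (B ∷ Bs) , (□ A ∷ ante Δ) ⇒ succ Δ) ∷ Y) ∷ G)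
                      (steps α (B ∷ Bs))
                  ++ [ ((α , Γ) ∷ (α ++ (B ∷ Bs) , [ A ] ⇒ []) ∷ X)
                         ∷ ((α ++ (B ∷ Bs) , (□ A ∷ ante Δ) ⇒ succ Δ) ∷ Y) ∷ G ]))
              (((α , Γ) ∷ X) ∷ ((α ++ (B ∷ Bs) , (□ A ∷ ante Δ) ⇒ succ Δ) ∷ Y) ∷ G)
  L[]  : ∀ {G X α A B M N M' N'} →
         Rule ((((α , M ⇒ (A ∷ N)) ∷ (α ∷ʳ A , M' ⇒ N') ∷ X) ∷ G)
               ∷ (((α , M ⇒ N) ∷ (α ∷ʳ A , (B ∷ M') ⇒ N') ∷ X) ∷ G) ∷ [])
              (((α , (⟦ A ⟧ B ∷ M) ⇒ N) ∷ (α ∷ʳ A , M' ⇒ N') ∷ X) ∷ G)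
  L[]new : ∀ {G X α A B M N} → NoLabel (α ∷ʳ A) X →
         Rule ((((α , M ⇒ (A ∷ N)) ∷ X) ∷ G)
               ∷ (((α , M ⇒ N) ∷ (α ∷ʳ A , [ B ] ⇒ []) ∷ X) ∷ G) ∷ [])
              (((α , (⟦ A ⟧ B ∷ M) ⇒ N) ∷ X) ∷ G)
  R[]  : ∀ {G X α A B M N M' N'} →
         Rule [ ((α , (A ∷ M) ⇒ N) ∷ (α ∷ʳ A , M' ⇒ (B ∷ N')) ∷ X) ∷ G ]
              (((α , M ⇒ (⟦ A ⟧ B ∷ N)) ∷ (α ∷ʳ A , M' ⇒ N') ∷ X) ∷ G)
  R[]new : ∀ {G X α A B M N} → NoLabel (α ∷ʳ A) X →
         Rule [ ((α , (A ∷ M) ⇒ N) ∷ (α ∷ʳ A , [] ⇒ [ B ]) ∷ X) ∷ G ]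
              (((α , M ⇒ (⟦ A ⟧ B ∷ N)) ∷ X) ∷ G)
  Lat  : ∀ {G X α A p M N M' N'} →
         Rule [ ((α , (atom p ∷ M) ⇒ N) ∷ (α ∷ʳ A , (atom p ∷ M') ⇒ N') ∷ X) ∷ G ]
              (((α , M ⇒ N) ∷ (α ∷ʳ A , (atom p ∷ M') ⇒ N') ∷ X) ∷ G)
  Rat  : ∀ {G X α A p M N M' N'} →
         Rule [ ((α , M ⇒ (atom p ∷ N)) ∷ (α ∷ʳ A , M' ⇒ (atom p ∷ N')) ∷ X) ∷ G ]
              (((α , M ⇒ N) ∷ (α ∷ʳ A , M' ⇒ (atom p ∷ N')) ∷ X) ∷ G)
  New  : ∀ {G X α A M N} →
         Rule [ ((α , [] ⇒ []) ∷ (α ∷ʳ A , M ⇒ N) ∷ X) ∷ G ]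
              (((α ∷ʳ A , M ⇒ N) ∷ X) ∷ G)
  Recall : ∀ {G X α A M N M' N'} →
         Rule [ ((α , (A ∷ M) ⇒ N) ∷ (α ∷ʳ A , M' ⇒ N') ∷ X) ∷ G ]
              (((α , M ⇒ N) ∷ (α ∷ʳ A , M' ⇒ N') ∷ X) ∷ G)
  perm : ∀ {G H} → G ≈ H → Rule [ G ] H

data Der : DHS → Set where
  node : ∀ {ps G} → Rule ps G → All Der ps → Der G

OccC : Fm → Comp → Set
OccC A (α , s) = (A ∈ α) ⊎ ((A ∈ ante s) ⊎ (A ∈ succ s))

OccD : Fm → DHS → Set
OccD A G = Any (Any (OccC A)) G

data InDer (A : Fm) : ∀ {G} → Der G → Set
data InDers (A : Fm) : ∀ {ps} → All Der ps → Set

data InDer A where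
  here : ∀ {G} {d : Der G} → OccD A G → InDer A d
  up   : ∀ {ps G} {r : Rule ps G} {ds : All Der ps} → InDers A ds → InDer A (node r ds)

data InDers A where
  hd : ∀ {p ps} {d : Der p} {ds : All Der ps} → InDer A d → InDers A (d All.∷ ds)
  tl : ∀ {p ps} {d : Der p} {ds : All Der ps} → InDers A ds → InDers A (d All.∷ ds)

-- Every rule of DHS_PAL is analytic: each formula occurring in a premise is a
-- subformula of a formula, or of an announcement, occurring in the conclusion.
-- The only formulas that are not plain subformulas of the principal formula are
-- announcements: the new labels α·A of [·]-rules, whose A is the left part of
-- [A]B, and the labels α·B₁⋯Bᵢ and formulas Bᵢ₊₁ of L□₃, which are all taken
-- from the label α·β of the conclusion. Being "a subformula of something
-- occurring" is transitive along a derivation, so the claim follows by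
-- induction on derivations.
module Submission where

open import Defs hiding (here)
open import Function using (_∘_)
open import Data.Product using (_×_; ∃-syntax; _,_; proj₁; proj₂)
open import Data.Sum using (inj₁; inj₂)
open import Data.List using ([]; _∷_; [_]; _++_; _∷ʳ_)
open import Data.List.Membership.Propositional using (_∈_; lose)
open import Data.List.Membership.Propositional.Properties using (∈-++⁺ʳ)
open import Data.List.Relation.Binary.Subset.Propositional using (_⊆_)
open import Data.List.Relation.Binary.Subset.Propositional.Properties using (xs⊆xs++ys)
open import Data.List.Relation.Unary.All as All using (All; []; _∷_)
open import Data.List.Relation.Unary.All.Properties using (++⁺; map⁺)
open import Data.List.Relation.Unary.Any using (Any; here; there)
open import Data.List.Relation.Binary.Permutation.Propositional.Properties using (Any-resp-↭)
open import Data.List.Relation.Binary.Pointwise using (Any-resp-Pointwise)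
open import Data.List.Properties using (∷ʳ-++)
open import Relation.Binary.PropositionalEquality using (refl; sym)

Sub-trans : ∀ {A B C} → Sub A B → Sub B C → Sub A C
Sub-trans s refl      = s
Sub-trans s (in¬ t)   = in¬ (Sub-trans s t)
Sub-trans s (in∧ˡ t)  = in∧ˡ (Sub-trans s t)
Sub-trans s (in∧ʳ t)  = in∧ʳ (Sub-trans s t)
Sub-trans s (in□ t)   = in□ (Sub-trans s t)
Sub-trans s (in[]ˡ t) = in[]ˡ (Sub-trans s t)
Sub-trans s (in[]ʳ t) = in[]ʳ (Sub-trans s t)

infix 4 _≼_ _≼ᶜ_ _≼ᴰ_

_≼_ : Fm → DHS → Set
A ≼ G = ∃[ B ] (OccD B G × Sub A B)

_≼ᶜ_ : Comp → DHS → Set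
c ≼ᶜ G = All (_≼ G) (proj₁ c) × All (_≼ G) (ante (proj₂ c)) × All (_≼ G) (succ (proj₂ c))

_≼ᴰ_ : DHS → DHS → Set
H ≼ᴰ G = All (All (_≼ᶜ G)) H

≼ᶜ-occ : ∀ {A c G} → c ≼ᶜ G → OccC A c → A ≼ G
≼ᶜ-occ (l , _ , _) (inj₁ m)        = All.lookup l m
≼ᶜ-occ (_ , a , _) (inj₂ (inj₁ m)) = All.lookup a m
≼ᶜ-occ (_ , _ , s) (inj₂ (inj₂ m)) = All.lookup s m

≼ᴰ-occ : ∀ {A H G} → H ≼ᴰ G → OccD A H → A ≼ G
≼ᴰ-occ (X≼ ∷ _) (here (here o))  = ≼ᶜ-occ (All.head X≼) o
≼ᴰ-occ (X≼ ∷ H≼) (here (there o)) = ≼ᴰ-occ (All.tail X≼ ∷ H≼) (here o)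
≼ᴰ-occ (_ ∷ H≼) (there o)         = ≼ᴰ-occ H≼ o

≼-trans : ∀ {A H G} → A ≼ H → H ≼ᴰ G → A ≼ G
≼-trans (B , o , s) H≼G with ≼ᴰ-occ H≼G o
... | C , o′ , t = C , o′ , Sub-trans s t

inside : ∀ {A B G} → Sub A B → OccD B G → A ≼ G
inside s o = _ , o , s

occurs : ∀ {A G} → OccD A G → A ≼ G
occurs = inside refl

listed : ∀ {xs G} → (∀ {A} → A ∈ xs → OccD A G) → All (_≼ G) xs
listed f = All.tabulate (occurs ∘ f)

comp-≼ᶜ : ∀ {c G} → (∀ {A} → OccC A c → OccD A G) → c ≼ᶜ G
comp-≼ᶜ f = listed (f ∘ inj₁) , listed (f ∘ inj₂ ∘ inj₁) , listed (f ∘ inj₂ ∘ inj₂)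

dseq-≼ᶜ : ∀ {X G} → (∀ {A} → Any (OccC A) X → OccD A G) → All (_≼ᶜ G) X
dseq-≼ᶜ f = All.tabulate (λ c∈X → comp-≼ᶜ (f ∘ lose c∈X))

dhs-≼ᴰ : ∀ {H G} → (∀ {A} → OccD A H → OccD A G) → H ≼ᴰ G
dhs-≼ᴰ f = All.tabulate (λ X∈H → dseq-≼ᶜ (f ∘ lose X∈H))

≈-occ : ∀ {A G H} → G ≈ H → OccD A G → OccD A H
≈-occ (_ , G↭ , G≋) = Any-resp-Pointwise DSeqEq-occ G≋ ∘ Any-resp-↭ G↭
  where
  CompEq-occ : ∀ {A c d} → CompEq c d → OccC A c → OccC A d
  CompEq-occ (refl , _ , _) (inj₁ m)         = inj₁ m
  CompEq-occ (refl , M↭ , _) (inj₂ (inj₁ m)) = inj₂ (inj₁ (Any-resp-↭ M↭ m))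
  CompEq-occ (refl , _ , N↭) (inj₂ (inj₂ m)) = inj₂ (inj₂ (Any-resp-↭ N↭ m))

  DSeqEq-occ : ∀ {A X Y} → DSeqEq X Y → Any (OccC A) X → Any (OccC A) Y
  DSeqEq-occ (_ , X↭ , X≋) = Any-resp-Pointwise CompEq-occ X≋ ∘ Any-resp-↭ X↭

steps-⊆ : ∀ α βs {lc} → lc ∈ steps α βs → proj₁ lc ⊆ α ++ βs × proj₂ lc ∈ α ++ βs
steps-⊆ α (B ∷ C ∷ Bs) (here refl) rewrite sym (∷ʳ-++ α B (C ∷ Bs)) =
  xs⊆xs++ys (α ∷ʳ B) (C ∷ Bs) , ∈-++⁺ʳ (α ∷ʳ B) (here refl)
steps-⊆ α (B ∷ C ∷ Bs) (there m) rewrite sym (∷ʳ-++ α B (C ∷ Bs)) = steps-⊆ (α ∷ʳ B) (C ∷ Bs) m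

module _ {X : DSeq} {G : DHS} where

  label₀ : ∀ {A α s} → A ∈ α → OccD A (((α , s) ∷ X) ∷ G)
  label₀ = here ∘ here ∘ inj₁

  ante₀ : ∀ {A α M N} → A ∈ M → OccD A (((α , M ⇒ N) ∷ X) ∷ G)
  ante₀ = here ∘ here ∘ inj₂ ∘ inj₁

  succ₀ : ∀ {A α M N} → A ∈ N → OccD A (((α , M ⇒ N) ∷ X) ∷ G)
  succ₀ = here ∘ here ∘ inj₂ ∘ inj₂

  label₁ : ∀ {A c α s} → A ∈ α → OccD A ((c ∷ (α , s) ∷ X) ∷ G)
  label₁ = here ∘ there ∘ here ∘ inj₁

  ante₁ : ∀ {A c α M N} → A ∈ M → OccD A ((c ∷ (α , M ⇒ N) ∷ X) ∷ G)
  ante₁ = here ∘ there ∘ here ∘ inj₂ ∘ inj₁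

  succ₁ : ∀ {A c α M N} → A ∈ N → OccD A ((c ∷ (α , M ⇒ N) ∷ X) ∷ G)
  succ₁ = here ∘ there ∘ here ∘ inj₂ ∘ inj₂

  head-replaced : ∀ {c c′} → c′ ≼ᶜ ((c ∷ X) ∷ G) → ((c′ ∷ X) ∷ G) ≼ᴰ ((c ∷ X) ∷ G)
  head-replaced c′≼ = (c′≼ ∷ dseq-≼ᶜ (here ∘ there)) ∷ dhs-≼ᴰ there

  heads-replaced : ∀ {c₁ c₂ c₁′ c₂′} → let H = (c₁ ∷ c₂ ∷ X) ∷ G in
                   c₁′ ≼ᶜ H → c₂′ ≼ᶜ H → ((c₁′ ∷ c₂′ ∷ X) ∷ G) ≼ᴰ H
  heads-replaced c₁′≼ c₂′≼ = (c₁′≼ ∷ c₂′≼ ∷ dseq-≼ᶜ (here ∘ there ∘ there)) ∷ dhs-≼ᴰ there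

  inserted : ∀ {c c′ e} → let H = (c ∷ X) ∷ G in
             c′ ≼ᶜ H → e ≼ᶜ H → ((c′ ∷ e ∷ X) ∷ G) ≼ᴰ H
  inserted c′≼ e≼ = (c′≼ ∷ e≼ ∷ dseq-≼ᶜ (here ∘ there)) ∷ dhs-≼ᴰ there

rule-≼ᴰ : ∀ {ps G} → Rule ps G → All (_≼ᴰ G) ps
rule-≼ᴰ ax = []
rule-≼ᴰ L¬ = head-replaced
  (listed label₀ , listed (ante₀ ∘ there) , inside (in¬ refl) (ante₀ (here refl)) ∷ listed succ₀) ∷ []
rule-≼ᴰ R¬ = head-replaced
  (listed label₀ , inside (in¬ refl) (succ₀ (here refl)) ∷ listed ante₀ , listed (succ₀ ∘ there)) ∷ []
rule-≼ᴰ L∧ = head-replaced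
  (listed label₀
  , inside (in∧ˡ refl) (ante₀ (here refl)) ∷ inside (in∧ʳ refl) (ante₀ (here refl)) ∷ listed (ante₀ ∘ there)
  , listed succ₀) ∷ []
rule-≼ᴰ R∧ =
  head-replaced (listed label₀ , listed ante₀ , inside (in∧ˡ refl) (succ₀ (here refl)) ∷ listed (succ₀ ∘ there)) ∷
  head-replaced (listed label₀ , listed ante₀ , inside (in∧ʳ refl) (succ₀ (here refl)) ∷ listed (succ₀ ∘ there)) ∷ []
rule-≼ᴰ L□₁ = head-replaced
  (listed label₀ , occurs (ante₀ (here refl)) ∷ inside (in□ refl) (ante₀ (here refl)) ∷ listed (ante₀ ∘ there)
  , listed succ₀) ∷ []
rule-≼ᴰ R□ =
  (((listed label₀ , listed ante₀ , listed (succ₀ ∘ there)) ∷ dseq-≼ᶜ (here ∘ there))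
  ∷ ((listed label₀ , [] , inside (in□ refl) (succ₀ (here refl)) ∷ []) ∷ [])
  ∷ dhs-≼ᴰ there) ∷ []
rule-≼ᴰ L□₂ =
  (dseq-≼ᶜ here
  ∷ ((listed (there ∘ label₀) , inside (in□ refl) (ante₀ (here refl)) ∷ listed (there ∘ ante₀)
     , listed (there ∘ succ₀)) ∷ dseq-≼ᶜ (there ∘ here ∘ there))
  ∷ dhs-≼ᴰ (there ∘ there)) ∷ []
rule-≼ᴰ (L□₃ {G = G} {X = X} {Y = Y} {α = α} {A = A} Γ Δ B Bs) =
  head-replaced (listed label₀ , listed ante₀ , announced (∈-++⁺ʳ α (here refl)) ∷ listed succ₀)
  ∷ ++⁺ (map⁺ (All.tabulate intermediate)) (inserted unchanged final ∷ [])
  where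
  D = (α ++ B ∷ Bs , (□ A ∷ ante Δ) ⇒ succ Δ) ∷ Y
  H = ((α , Γ) ∷ X) ∷ D ∷ G

  announced : ∀ {C} → C ∈ α ++ B ∷ Bs → C ≼ H
  announced m = occurs (there (label₀ m))

  unchanged : (α , Γ) ≼ᶜ H
  unchanged = comp-≼ᶜ (here ∘ here)

  intermediate : ∀ {lc} → lc ∈ steps α (B ∷ Bs) →
                 (((α , Γ) ∷ (proj₁ lc , [] ⇒ [ proj₂ lc ]) ∷ X) ∷ D ∷ G) ≼ᴰ H
  intermediate m with steps-⊆ α (B ∷ Bs) m
  ... | l⊆ , C∈ = inserted unchanged (All.tabulate (announced ∘ l⊆) , [] , announced C∈ ∷ [])

  final : (α ++ B ∷ Bs , [ A ] ⇒ []) ≼ᶜ H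
  final = All.tabulate announced , inside (in□ refl) (there (ante₀ (here refl))) ∷ [] , []
rule-≼ᴰ L[] =
  head-replaced (listed label₀ , listed (ante₀ ∘ there) , inside (in[]ˡ refl) (ante₀ (here refl)) ∷ listed succ₀)
  ∷ heads-replaced (listed label₀ , listed (ante₀ ∘ there) , listed succ₀)
                   (listed label₁ , inside (in[]ʳ refl) (ante₀ (here refl)) ∷ listed ante₁ , listed succ₁)
  ∷ []
rule-≼ᴰ (L[]new _) =
  head-replaced (listed label₀ , listed (ante₀ ∘ there) , inside (in[]ˡ refl) (ante₀ (here refl)) ∷ listed succ₀)
  ∷ inserted (listed label₀ , listed (ante₀ ∘ there) , listed succ₀)
             (++⁺ (listed label₀) (inside (in[]ˡ refl) (ante₀ (here refl)) ∷ [])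
             , inside (in[]ʳ refl) (ante₀ (here refl)) ∷ [] , [])
  ∷ []
rule-≼ᴰ R[] =
  heads-replaced (listed label₀ , inside (in[]ˡ refl) (succ₀ (here refl)) ∷ listed ante₀ , listed (succ₀ ∘ there))
                 (listed label₁ , listed ante₁ , inside (in[]ʳ refl) (succ₀ (here refl)) ∷ listed succ₁)
  ∷ []
rule-≼ᴰ (R[]new _) =
  inserted (listed label₀ , inside (in[]ˡ refl) (succ₀ (here refl)) ∷ listed ante₀ , listed (succ₀ ∘ there))
           (++⁺ (listed label₀) (inside (in[]ˡ refl) (succ₀ (here refl)) ∷ [])
           , [] , inside (in[]ʳ refl) (succ₀ (here refl)) ∷ [])
  ∷ []
rule-≼ᴰ Lat = head-replaced (listed label₀ , occurs (ante₁ (here refl)) ∷ listed ante₀ , listed succ₀) ∷ []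
rule-≼ᴰ Rat = head-replaced (listed label₀ , listed ante₀ , occurs (succ₁ (here refl)) ∷ listed succ₀) ∷ []
rule-≼ᴰ (New {α = α} {A = A}) =
  (((listed (label₀ ∘ xs⊆xs++ys α [ A ]) , [] , []) ∷ dseq-≼ᶜ here) ∷ dhs-≼ᴰ there) ∷ []
rule-≼ᴰ (Recall {α = α}) =
  head-replaced (listed label₀ , occurs (label₁ (∈-++⁺ʳ α (here refl))) ∷ listed ante₀ , listed succ₀) ∷ []
rule-≼ᴰ (perm G≈H) = dhs-≼ᴰ (≈-occ G≈H) ∷ []

InDer-≼ : ∀ {A G} (d : Der G) → InDer A d → A ≼ G
InDers-≼ : ∀ {A ps G} (ds : All Der ps) → All (_≼ᴰ G) ps → InDers A ds → A ≼ G

InDer-≼ _ (InDer.here o)     = occurs o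
InDer-≼ (node r ds) (up i)   = InDers-≼ ds (rule-≼ᴰ r) i

InDers-≼ (d ∷ _) (P≼G ∷ _) (hd i)    = ≼-trans (InDer-≼ d i) P≼G
InDers-≼ (_ ∷ ds) (_ ∷ Ps≼G) (tl i) = InDers-≼ ds Ps≼G i

mainTheorem4 : ∀ {G : DHS} (d : Der G) (A : Fm) → InDer A d →
                 ∃[ B ] (OccD B G × Sub A B)
mainTheorem4 d _ = InDer-≼ d
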